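{- Let $m>5$ and let $G=\Theta(s_1,s_2,\ldots,s_m)$ be a generalized theta graph in which the $s_i$ are pairwise distinct. Then $\beta(G)\leq m-2$.
   Context: Graphs are simple, connected, finite. A set $W\subseteq V(G)$ is resolving if for any distinct $u,v$ there is $w\in W$ with $d(u,w)\ne d(v,w)$; $\beta(G)$ is the minimum size of a resolving set. For positive integers $s_1\le\cdots\le s_m$, $\Theta(s_1,\ldots,s_m)$ consists of two vertices $c_1,c_2$ (centers) joined by $m$ internally disjoint paths, the $i$-th having $s_i$ internal vertices (length $s_i+1$). -}

module Defs where

open import Data.Nat using (ℕ; zero; suc; _≤_; _+_)
open import Data.Fin using (Fin; toℕ)
open import Data.List using (List; length)
open import Data.List.Membership.Propositional using (_∈_)
open import Data.Product using (Σ; _×_; ∃-syntax)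
open import Relation.Binary.PropositionalEquality using (_≡_; _≢_)

record Graph : Set₁ where
  field
    V   : Set
    Adj : V → V → Set

module _ (G : Graph) where
  open Graph G

  data Walk : V → V → ℕ → Set where
    here : ∀ {u} → Walk u u zero
    step : ∀ {u w v n} → Adj u w → Walk w v n → Walk u v (suc n)

  Dist : V → V → ℕ → Set
  Dist u v n = Walk u v n × (∀ k → Walk u v k → n ≤ k)

  Resolving : List V → Set
  Resolving W = ∀ u v → u ≢ v →
    ∃[ w ] (w ∈ W × (∀ a b → Dist u w a → Dist v w b → a ≢ b))

  MetricDim≤ : ℕ → Set
  MetricDim≤ k = ∃[ W ] (Resolving W × length W ≤ k)

data ThetaV (m : ℕ) (s : Fin m → ℕ) : Set where
  c₁ c₂ : ThetaV m s
  inner : (i : Fin m) → Fin (s i) → ThetaV m s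

-- The i-th path is c₁ — inner i 0 — inner i 1 — … — inner i (s i - 1) — c₂.
data ThetaAdj (m : ℕ) (s : Fin m → ℕ) : ThetaV m s → ThetaV m s → Set where
  c₁-first  : ∀ i j → toℕ j ≡ 0 → ThetaAdj m s c₁ (inner i j)
  first-c₁  : ∀ i j → toℕ j ≡ 0 → ThetaAdj m s (inner i j) c₁
  last-c₂   : ∀ i j → suc (toℕ j) ≡ s i → ThetaAdj m s (inner i j) c₂
  c₂-last   : ∀ i j → suc (toℕ j) ≡ s i → ThetaAdj m s c₂ (inner i j)
  next      : ∀ i j k → toℕ k ≡ suc (toℕ j) → ThetaAdj m s (inner i j) (inner i k)
  prev      : ∀ i j k → toℕ k ≡ suc (toℕ j) → ThetaAdj m s (inner i k) (inner i j)

Theta : (m : ℕ) → (Fin m → ℕ) → Graph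
Theta m s = record { V = ThetaV m s ; Adj = ThetaAdj m s }

module Submission where

-- Let path 0 be the shortest, so L = s₀ + 1 is the distance between the centres, and let d₁, d₂
-- be the distances to c₁, c₂. On a path k with s_k ≥ s₀ + 2 put w at distance r = ⌊(s_k − s₀)/2⌋
-- from c₁. Every vertex x off path k reaches w fastest through c₁, so d(x, w) = r + d₁ x, while
-- vertices on path k are strictly closer than r + d₁. Hence two such landmarks on different paths
-- see equal d₁ on every pair they do not resolve, and their mirror images (exchanging c₁ and c₂) see
-- equal d₂. Place landmarks measured from c₁ on paths 2 and 3 and mirrored ones on paths 4, …, m − 1:
-- m − 2 vertices. A pair with the same (d₁, d₂) lies on one path, where (d₁, d₂) fixes the vertex,
-- or on two different paths; a landmark on either of them separates the pair, and paths 0 and 1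
-- are impossible since d₁ + d₂ = L on path 0, while d₁ + d₂ ≤ L on path i forces s_i ≤ s₀ < s₁.

open import Defs
open import Data.Empty using (⊥; ⊥-elim)
open import Data.Fin using (Fin; zero; suc; toℕ; fromℕ<; opposite)
import Data.Fin.Properties as Fin
open import Data.List using (tabulate)
open import Data.List.Properties using (length-tabulate)
open import Data.List.Membership.Propositional.Properties using (∈-tabulate⁺)
open import Data.Nat using (ℕ; zero; suc; _+_; _∸_; _⊓_; _≤_; _<_; z≤n; s≤s; s≤s⁻¹; z<s; ∣_-_∣; _≟_)
open import Data.Nat.Properties
open import Data.Nat.Tactic.RingSolver using (solve-∀)
open import Data.Product using (_,_; _×_; proj₁; proj₂; ∃-syntax)
open import Data.Sum using (inj₁; inj₂)
open import Relation.Binary.Definitions using (Symmetric; tri<; tri≈; tri>)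
open import Relation.Binary.PropositionalEquality
open import Relation.Nullary using (¬_; Dec; yes; no)

module GraphDistance (G : Graph) where
  open Graph G

  Dist-functional : ∀ {u w a b} → Dist G u w a → Dist G u w b → a ≡ b
  Dist-functional (p , p-shortest) (q , q-shortest) = ≤-antisym (p-shortest _ q) (q-shortest _ p)

  _++ʷ_ : ∀ {u v w a b} → Walk G u v a → Walk G v w b → Walk G u w (a + b)
  here     ++ʷ q = q
  step e p ++ʷ q = step e (p ++ʷ q)

  reverse : Symmetric Adj → ∀ {u v n} → Walk G u v n → Walk G v u n
  reverse Adj-sym here = here
  reverse Adj-sym (step {n = n} e p) =
    subst (Walk G _ _) (+-comm n 1) (reverse Adj-sym p ++ʷ step (Adj-sym e) here)

  shorter-walk : ∀ {u v a b} → Walk G u v a → Walk G u v b → Walk G u v (a ⊓ b)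
  shorter-walk {a = a} {b} p q with ⊓-sel a b
  ... | inj₁ a⊓b≡a = subst (Walk G _ _) (sym a⊓b≡a) p
  ... | inj₂ a⊓b≡b = subst (Walk G _ _) (sym a⊓b≡b) q

  Lipschitz : (V → ℕ) → Set
  Lipschitz f = ∀ {u v} → Adj u v → f u ≤ suc (f v)

  Lipschitz-walk : ∀ {f} → Lipschitz f → ∀ {u w n} → Walk G u w n → f u ≤ n + f w
  Lipschitz-walk lip here       = ≤-refl
  Lipschitz-walk lip (step e p) = ≤-trans (lip e) (s≤s (Lipschitz-walk lip p))

  Lipschitz⇒Dist : ∀ {f w} → Lipschitz f → f w ≡ 0 → (∀ x → Walk G x w (f x)) →
                   ∀ x → Dist G x w (f x)
  Lipschitz⇒Dist {f} lip fw≡0 walk x =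
    walk x , λ n p → subst (f x ≤_) (trans (cong (n +_) fw≡0) (+-identityʳ n)) (Lipschitz-walk lip p)

  Walk-image : (σ : V → V) → (∀ {u v} → Adj u v → Adj (σ u) (σ v)) →
               ∀ {u v n} → Walk G u v n → Walk G (σ u) (σ v) n
  Walk-image σ σ-adj here       = here
  Walk-image σ σ-adj (step e p) = step (σ-adj e) (Walk-image σ σ-adj p)

  Dist-image : (σ : V → V) → (∀ {u v} → Adj u v → Adj (σ u) (σ v)) → (∀ x → σ (σ x) ≡ x) →
               ∀ {x w a} → Dist G x w a → Dist G (σ x) (σ w) a
  Dist-image σ σ-adj σ-involutive {x} {w} (p , p-shortest) =
    Walk-image σ σ-adj p , λ n q →
      p-shortest n (subst₂ (λ u v → Walk G u v n) (σ-involutive x) (σ-involutive w) (Walk-image σ σ-adj q))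

  resolving-by-coordinates : ∀ {n} (w : Fin n → V) (d : Fin n → V → ℕ) →
    (∀ i x → Dist G x (w i) (d i x)) → (∀ x y → (∀ i → d i x ≡ d i y) → x ≡ y) →
    Resolving G (tabulate w)
  resolving-by-coordinates {n} w d d-isDist d-injective u v u≢v
    with Fin.all? (λ i → d i u ≟ d i v)
  ... | yes same = ⊥-elim (u≢v (d-injective u v same))
  ... | no ¬same with Fin.¬∀⟶∃¬ n _ (λ i → d i u ≟ d i v) ¬same
  ...   | i , dᵢu≢dᵢv = w i , ∈-tabulate⁺ i , λ a b u-dist v-dist a≡b →
          dᵢu≢dᵢv (trans (Dist-functional (d-isDist i u) u-dist)
                         (trans a≡b (Dist-functional v-dist (d-isDist i v))))

∣1+m-m∣≡1 : ∀ m → ∣ suc m - m ∣ ≡ 1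
∣1+m-m∣≡1 zero    = refl
∣1+m-m∣≡1 (suc m) = ∣1+m-m∣≡1 m

∣1+m-n∣≤1+∣m-n∣ : ∀ m n → ∣ suc m - n ∣ ≤ suc ∣ m - n ∣
∣1+m-n∣≤1+∣m-n∣ m n =
  ≤-trans (∣-∣-triangle (suc m) m n) (≤-reflexive (cong (_+ ∣ m - n ∣) (∣1+m-m∣≡1 m)))

∣m-n∣≤1+∣1+m-n∣ : ∀ m n → ∣ m - n ∣ ≤ suc ∣ suc m - n ∣
∣m-n∣≤1+∣1+m-n∣ m n =
  ≤-trans (∣-∣-triangle m (suc m) n)
          (≤-reflexive (cong (_+ ∣ suc m - n ∣) (trans (∣-∣-comm m (suc m)) (∣1+m-m∣≡1 m))))

∣m-n∣<n+m : ∀ {m n} → 0 < m → 0 < n → ∣ m - n ∣ < n + m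
∣m-n∣<n+m {suc m} {suc n} _ _ =
  s≤s (≤-trans (∣m-n∣≤m⊔n m n) (≤-trans (m⊔n≤m+n m n)
      (≤-trans (≤-reflexive (+-comm m n)) (+-monoʳ-≤ n (n≤1+n m)))))

∣m-n∣<n+o : ∀ {m n k o} → m ≤ n + k → k < n + o → 0 < o → ∣ m - n ∣ < n + o
∣m-n∣<n+o {m} {n} {k} {o} m≤n+k k<n+o 0<o with ≤-total m n
... | inj₁ m≤n = subst (_< n + o) (sym (m≤n⇒∣m-n∣≡n∸m m≤n))
                       (≤-<-trans (m∸n≤m n m) (m<m+n n 0<o))
... | inj₂ n≤m = subst (_< n + o) (sym (m≤n⇒∣n-m∣≡n∸m n≤m))
                       (≤-<-trans (subst (m ∸ n ≤_) (m+n∸m≡n n k) (∸-monoˡ-≤ n m≤n+k)) k<n+o)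

halve : ∀ n → ∃[ r ] ∃[ e ] (e ≤ 1 × n ≡ r + r + e)
halve zero          = 0 , 0 , z≤n , refl
halve (suc zero)    = 0 , 1 , s≤s z≤n , refl
halve (suc (suc n)) with halve n
... | r , e , e≤1 , n≡r+r+e = suc r , e , e≤1 , cong suc (trans (cong suc n≡r+r+e) (cong (_+ e) (sym (+-suc r r))))

-- S = r + far with r ≥ 1 and far ∈ {r + s₀, r + s₀ + 1}: take r = ⌊(S - s₀) / 2⌋.
middle-split : ∀ {s₀ S} → s₀ + 2 ≤ S →
  ∃[ r′ ] ∃[ far ] (S ≡ suc r′ + far × far ≤ suc r′ + suc s₀ × suc r′ + suc s₀ ≤ suc far)
middle-split {s₀} {S} s₀+2≤S with halve (S ∸ (s₀ + 2))
... | h , e , e≤1 , eq = h , s₀ + suc h + e , S≡ , far≤ , ≤far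
  where
  S≡ : S ≡ suc h + (s₀ + suc h + e)
  S≡ = begin
    S                          ≡⟨ sym (m∸n+n≡m s₀+2≤S) ⟩
    S ∸ (s₀ + 2) + (s₀ + 2)    ≡⟨ cong (_+ (s₀ + 2)) eq ⟩
    h + h + e + (s₀ + 2)       ≡⟨ regroup h e s₀ ⟩
    suc h + (s₀ + suc h + e)   ∎
    where
    open ≡-Reasoning
    regroup : ∀ h e s₀ → h + h + e + (s₀ + 2) ≡ suc h + (s₀ + suc h + e)
    regroup = solve-∀
  far≤ : s₀ + suc h + e ≤ suc h + suc s₀
  far≤ = ≤-trans (+-monoʳ-≤ (s₀ + suc h) e≤1) (≤-reflexive (regroup s₀ h))
    where
    regroup : ∀ s₀ h → s₀ + suc h + 1 ≡ suc h + suc s₀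
    regroup = solve-∀
  ≤far : suc h + suc s₀ ≤ suc (s₀ + suc h + e)
  ≤far = ≤-trans (≤-reflexive (regroup s₀ h)) (s≤s (m≤m+n (s₀ + suc h) e))
    where
    regroup : ∀ s₀ h → suc h + suc s₀ ≡ suc (s₀ + suc h)
    regroup = solve-∀

m⊓n≤o∧o<m⇒n≤o : ∀ {m n o} → m ⊓ n ≤ o → o < m → n ≤ o
m⊓n≤o∧o<m⇒n≤o {m} {n} m⊓n≤o o<m with ⊓-sel m n
... | inj₁ m⊓n≡m = ⊥-elim (<⇒≱ o<m (subst (_≤ _) m⊓n≡m m⊓n≤o))
... | inj₂ m⊓n≡n = subst (_≤ _) m⊓n≡n m⊓n≤o

⊓-pair-order : ∀ {p q p′ q′ L} → 0 < L → p < p′ → p + q ≡ p′ + q′ →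
  p ⊓ (q + L) ≡ p′ ⊓ (q′ + L) → q ⊓ (p + L) ≢ q′ ⊓ (p′ + L)
⊓-pair-order {p} {q} {p′} {q′} {L} 0<L p<p′ sum eq₁ eq₂ = <-asym p<q′ q′<p
  where
  q′<q : q′ < q
  q′<q = ≰⇒> λ q≤q′ → <-irrefl sum (+-mono-<-≤ p<p′ q≤q′)
  q′+L≤p : q′ + L ≤ p
  q′+L≤p = m⊓n≤o∧o<m⇒n≤o (subst (_≤ p) eq₁ (m⊓n≤m p (q + L))) p<p′
  p+L≤q′ : p + L ≤ q′
  p+L≤q′ = m⊓n≤o∧o<m⇒n≤o (subst (_≤ q′) (sym eq₂) (m⊓n≤m q′ (p′ + L))) q′<q
  p<q′ : p < q′
  p<q′ = <-≤-trans (m<m+n p 0<L) p+L≤q′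
  q′<p : q′ < p
  q′<p = <-≤-trans (m<m+n q′ 0<L) q′+L≤p

⊓-pair-injective : ∀ {p q p′ q′ L} → 0 < L → p + q ≡ p′ + q′ →
  p ⊓ (q + L) ≡ p′ ⊓ (q′ + L) → q ⊓ (p + L) ≡ q′ ⊓ (p′ + L) → p ≡ p′
⊓-pair-injective {p} {q} {p′} {q′} 0<L sum eq₁ eq₂ with <-cmp p p′
... | tri< p<p′ _ _ = ⊥-elim (⊓-pair-order 0<L p<p′ sum eq₁ eq₂)
... | tri≈ _ p≡p′ _ = p≡p′
... | tri> _ _ p′<p = ⊥-elim (⊓-pair-order 0<L p′<p (sym sum) (sym eq₁) (sym eq₂))

⊓-pair-sum : ∀ {p q L} → 0 < p → 0 < q → p ⊓ (q + L) + q ⊓ (p + L) ≤ L → p + q ≤ L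
⊓-pair-sum {p} {q} {L} 0<p 0<q sum≤L with ⊓-sel p (q + L) | ⊓-sel q (p + L)
... | inj₁ eq₁ | inj₁ eq₂ = subst₂ (λ a b → a + b ≤ L) eq₁ eq₂ sum≤L
... | inj₂ eq₁ | _ =
  ⊥-elim (<⇒≱ (m<n+m L 0<q) (≤-trans (≤-reflexive (sym eq₁)) (≤-trans (m≤m+n _ _) sum≤L)))
... | inj₁ _ | inj₂ eq₂ =
  ⊥-elim (<⇒≱ (m<n+m L 0<p) (≤-trans (≤-reflexive (sym eq₂)) (≤-trans (m≤n+m _ _) sum≤L)))

-- inner i j cuts path i into a segment of seg₁ j edges ending at c₁ and one of seg₂ j edges ending at c₂.
seg₁ seg₂ : ∀ {m} → Fin m → ℕ
seg₁ j = suc (toℕ j)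
seg₂ j = suc (toℕ (opposite j))

seg₁+seg₂ : ∀ {m} (j : Fin m) → seg₁ j + seg₂ j ≡ suc m
seg₁+seg₂ {m} j = cong suc (begin
  toℕ j + seg₂ j                   ≡⟨ +-comm (toℕ j) (seg₂ j) ⟩
  suc (toℕ (opposite j) + toℕ j)   ≡⟨ sym (+-suc (toℕ (opposite j)) (toℕ j)) ⟩
  toℕ (opposite j) + seg₁ j        ≡⟨ cong (_+ seg₁ j) (Fin.opposite-prop j) ⟩
  m ∸ seg₁ j + seg₁ j              ≡⟨ m∸n+n≡m (Fin.toℕ<n j) ⟩
  m                                ∎)
  where open ≡-Reasoning

seg₂-opposite : ∀ {m} (j : Fin m) → seg₂ (opposite j) ≡ seg₁ j
seg₂-opposite j = cong suc (cong toℕ (Fin.opposite-involutive j))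

seg₂-first : ∀ {m} (j : Fin m) → toℕ j ≡ 0 → seg₂ j ≡ m
seg₂-first j j≡0 = suc-injective (trans (cong (λ t → suc t + seg₂ j) (sym j≡0)) (seg₁+seg₂ j))

seg₂-last : ∀ {m} (j : Fin m) → seg₁ j ≡ m → seg₂ j ≡ 1
seg₂-last {m} j j≡m = +-cancelˡ-≡ m _ _ (trans (cong (_+ seg₂ j) (sym j≡m)) (trans (seg₁+seg₂ j) (+-comm 1 m)))

opposite-next : ∀ {m} {j k : Fin m} → toℕ k ≡ suc (toℕ j) → toℕ (opposite j) ≡ suc (toℕ (opposite k))
opposite-next {m} {j} {k} k≡1+j = begin
  toℕ (opposite j)       ≡⟨ Fin.opposite-prop j ⟩
  m ∸ suc (toℕ j)        ≡⟨ cong (m ∸_) (sym k≡1+j) ⟩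
  suc m ∸ suc (toℕ k)    ≡⟨ +-∸-assoc 1 (Fin.toℕ<n k) ⟩
  suc (m ∸ suc (toℕ k))  ≡⟨ cong suc (sym (Fin.opposite-prop k)) ⟩
  suc (toℕ (opposite k)) ∎
  where open ≡-Reasoning

module ThetaGraph {n : ℕ} (s : Fin (suc n) → ℕ) (s-pos : ∀ i → 0 < s i)
                  (s₀-shortest : ∀ i → s zero ≤ s i) where

  G : Graph
  G = Theta (suc n) s

  open Graph G
  open GraphDistance G

  Adj-sym : ∀ {u v} → Adj u v → Adj v u
  Adj-sym (c₁-first i j j≡0)    = first-c₁ i j j≡0
  Adj-sym (first-c₁ i j j≡0)    = c₁-first i j j≡0
  Adj-sym (last-c₂ i j j≡last)  = c₂-last i j j≡last
  Adj-sym (c₂-last i j j≡last)  = last-c₂ i j j≡last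
  Adj-sym (next i j k k≡1+j)    = prev i j k k≡1+j
  Adj-sym (prev i j k k≡1+j)    = next i j k k≡1+j

  σ : V → V
  σ c₁          = c₂
  σ c₂          = c₁
  σ (inner i j) = inner i (opposite j)

  σ-involutive : ∀ x → σ (σ x) ≡ x
  σ-involutive c₁          = refl
  σ-involutive c₂          = refl
  σ-involutive (inner i j) = cong (inner i) (Fin.opposite-involutive j)

  σ-adj : ∀ {u v} → Adj u v → Adj (σ u) (σ v)
  σ-adj (c₁-first i j j≡0)   = c₂-last i (opposite j) (seg₂-first j j≡0)
  σ-adj (first-c₁ i j j≡0)   = last-c₂ i (opposite j) (seg₂-first j j≡0)
  σ-adj (last-c₂ i j j≡last) = first-c₁ i (opposite j) (suc-injective (seg₂-last j j≡last))
  σ-adj (c₂-last i j j≡last) = c₁-first i (opposite j) (suc-injective (seg₂-last j j≡last))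
  σ-adj (next i j k k≡1+j)   = prev i (opposite k) (opposite j) (opposite-next k≡1+j)
  σ-adj (prev i j k k≡1+j)   = next i (opposite k) (opposite j) (opposite-next k≡1+j)

  to-c₁ : ∀ {i} (j : Fin (s i)) → Walk G (inner i j) c₁ (seg₁ j)
  to-c₁ {i} j = go (toℕ j) j refl
    where
    go : ∀ d (j : Fin (s i)) → toℕ j ≡ d → Walk G (inner i j) c₁ (suc d)
    go zero    j j≡0   = step (first-c₁ i j j≡0) here
    go (suc d) j j≡1+d = step (prev i j′ j (trans j≡1+d (cong suc (sym j′≡d)))) (go d j′ j′≡d)
      where
      d<s : d < s i
      d<s = <⇒≤ (subst (_< s i) j≡1+d (Fin.toℕ<n j))
      j′ : Fin (s i)
      j′ = fromℕ< d<s
      j′≡d : toℕ j′ ≡ d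
      j′≡d = Fin.toℕ-fromℕ< d<s

  to-c₂ : ∀ {i} (j : Fin (s i)) → Walk G (inner i j) c₂ (seg₂ j)
  to-c₂ {i} j = subst (λ x → Walk G x c₂ (seg₂ j)) (σ-involutive (inner i j))
                      (Walk-image σ σ-adj (to-c₁ (opposite j)))

  walk-along : ∀ {i} d (j j′ : Fin (s i)) → toℕ j + d ≡ toℕ j′ → Walk G (inner i j) (inner i j′) d
  walk-along {i} zero j j′ j+0≡j′ =
    subst (λ x → Walk G (inner i j) (inner i x) 0) (Fin.toℕ-injective (trans (sym (+-identityʳ _)) j+0≡j′)) here
  walk-along {i} (suc d) j j′ j+1+d≡j′ = step (next i j j₁ j₁≡1+j) (walk-along d j₁ j′ j₁+d≡j′)
    where
    1+j<s : suc (toℕ j) < s i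
    1+j<s = ≤-<-trans (subst (toℕ j <_) j+1+d≡j′ (m<m+n (toℕ j) z<s)) (Fin.toℕ<n j′)
    j₁ : Fin (s i)
    j₁ = fromℕ< 1+j<s
    j₁≡1+j : toℕ j₁ ≡ suc (toℕ j)
    j₁≡1+j = Fin.toℕ-fromℕ< 1+j<s
    j₁+d≡j′ : toℕ j₁ + d ≡ toℕ j′
    j₁+d≡j′ = trans (cong (_+ d) j₁≡1+j) (trans (sym (+-suc (toℕ j) d)) j+1+d≡j′)

  between : ∀ {i} (j j′ : Fin (s i)) → Walk G (inner i j) (inner i j′) ∣ toℕ j - toℕ j′ ∣
  between j j′ with ≤-total (toℕ j) (toℕ j′)
  ... | inj₁ j≤j′ = subst (Walk G _ _) (sym (m≤n⇒∣m-n∣≡n∸m j≤j′))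
                          (walk-along _ j j′ (m+[n∸m]≡n j≤j′))
  ... | inj₂ j′≤j = subst (Walk G _ _) (sym (m≤n⇒∣n-m∣≡n∸m j′≤j))
                          (reverse Adj-sym (walk-along _ j′ j (m+[n∸m]≡n j′≤j)))

  L : ℕ
  L = suc (s zero)

  first₀ : Fin (s zero)
  first₀ = fromℕ< (s-pos zero)

  c₂→c₁ : Walk G c₂ c₁ L
  c₂→c₁ = subst (Walk G c₂ c₁) (cong suc (seg₂-first first₀ (Fin.toℕ-fromℕ< (s-pos zero))))
                (reverse Adj-sym (step (c₁-first zero first₀ (Fin.toℕ-fromℕ< (s-pos zero))) (to-c₂ first₀)))

  -- d₁ x is the distance from x to c₁ (only its Lipschitz property and d₁-walk are needed).
  d₁ : V → ℕ
  d₁ c₁          = 0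
  d₁ c₂          = L
  d₁ (inner i j) = seg₁ j ⊓ (seg₂ j + L)

  d₁-Lipschitz : Lipschitz d₁
  d₁-Lipschitz (c₁-first i j j≡0)   = z≤n
  d₁-Lipschitz (first-c₁ i j j≡0)   = ≤-trans (m⊓n≤m _ _) (s≤s (≤-reflexive j≡0))
  d₁-Lipschitz (last-c₂ i j j≡last) = ≤-trans (m⊓n≤n _ _) (≤-reflexive (cong (_+ L) (seg₂-last j j≡last)))
  d₁-Lipschitz (c₂-last i j j≡last) =
    ⊓-glb (s≤s (subst (s zero ≤_) (sym j≡last) (s₀-shortest i))) (m≤n⇒m≤1+n (m≤n+m L (seg₂ j)))
  d₁-Lipschitz (next i j k k≡1+j)   =
    ⊓-mono-≤ (m≤n⇒m≤1+n (≤-trans (n≤1+n _) (≤-reflexive (cong suc (sym k≡1+j)))))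
             (≤-reflexive (cong (λ t → suc t + L) (opposite-next k≡1+j)))
  d₁-Lipschitz (prev i j k k≡1+j)   =
    ⊓-mono-≤ (≤-reflexive (cong suc k≡1+j))
             (m≤n⇒m≤1+n (+-monoˡ-≤ L (≤-trans (n≤1+n _) (≤-reflexive (sym (cong suc (opposite-next k≡1+j)))))))

  d₁-walk : ∀ x → Walk G x c₁ (d₁ x)
  d₁-walk c₁          = here
  d₁-walk c₂          = c₂→c₁
  d₁-walk (inner i j) = shorter-walk (to-c₁ j) (to-c₂ j ++ʷ c₂→c₁)

  d₂ : V → ℕ
  d₂ x = d₁ (σ x)

  d₂-inner : ∀ {i} (j : Fin (s i)) → d₂ (inner i j) ≡ seg₂ j ⊓ (seg₁ j + L)
  d₂-inner j = cong (λ t → seg₂ j ⊓ (t + L)) (seg₂-opposite j)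

  same-path-profile : ∀ {i} (j j′ : Fin (s i)) →
    d₁ (inner i j) ≡ d₁ (inner i j′) → d₂ (inner i j) ≡ d₂ (inner i j′) → j ≡ j′
  same-path-profile j j′ d₁≡ d₂≡ =
    Fin.toℕ-injective (suc-injective (⊓-pair-injective z<s
      (trans (seg₁+seg₂ j) (sym (seg₁+seg₂ j′))) d₁≡ (trans (sym (d₂-inner j)) (trans d₂≡ (d₂-inner j′)))))

  shortest-path-profile : ∀ (j : Fin (s zero)) → d₁ (inner zero j) + d₂ (inner zero j) ≤ L
  shortest-path-profile j =
    ≤-trans (+-mono-≤ (m⊓n≤m (seg₁ j) (seg₂ j + L)) (subst (_≤ seg₂ j) (sym (d₂-inner j)) (m⊓n≤m (seg₂ j) (seg₁ j + L))))
            (≤-reflexive (seg₁+seg₂ j))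

  profile-sum≤L⇒shortest : ∀ {i} (j : Fin (s i)) → d₁ (inner i j) + d₂ (inner i j) ≤ L → s i ≤ s zero
  profile-sum≤L⇒shortest j sum≤L =
    s≤s⁻¹ (subst (_≤ L) (seg₁+seg₂ j)
      (⊓-pair-sum z<s z<s (subst (λ t → d₁ (inner _ j) + t ≤ L) (d₂-inner j) sum≤L)))

  OnPath : Fin (suc n) → V → Set
  OnPath k c₁          = ⊥
  OnPath k c₂          = ⊥
  OnPath k (inner i j) = i ≡ k

  OnPath? : ∀ k x → Dec (OnPath k x)
  OnPath? k c₁          = no λ ()
  OnPath? k c₂          = no λ ()
  OnPath? k (inner i j) = i Fin.≟ k

  OnPath-unique : ∀ {k k′ x} → OnPath k x → OnPath k′ x → k ≡ k′
  OnPath-unique {x = inner i j} i≡k i≡k′ = trans (sym i≡k) i≡k′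

  OnPath-σ : ∀ {k} x → OnPath k (σ x) → OnPath k x
  OnPath-σ (inner i j) i≡k = i≡k

  record Landmark (μ : V → ℕ) (k : Fin (suc n)) : Set where
    field
      offset   : ℕ
      vertex   : V
      dist     : V → ℕ
      isDist   : ∀ x → Dist G x vertex (dist x)
      off-path : ∀ x → ¬ OnPath k x → dist x ≡ offset + μ x
      on-path  : ∀ x → OnPath k x → dist x < offset + μ x

  module _ {μ : V → ℕ} {k : Fin (suc n)} (A : Landmark μ k) where
    open Landmark A

    on-path-closer : ∀ {x y} → OnPath k x → ¬ OnPath k y → dist x ≡ dist y → μ y < μ x
    on-path-closer {x} {y} x∈k y∉k dx≡dy =
      +-cancelˡ-< offset (μ y) (μ x) (subst (_< offset + μ x) (trans dx≡dy (off-path y y∉k)) (on-path x x∈k))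

    off-path-injective : ∀ {x y} → ¬ OnPath k x → ¬ OnPath k y → dist x ≡ dist y → μ x ≡ μ y
    off-path-injective {x} {y} x∉k y∉k dx≡dy =
      +-cancelˡ-≡ offset _ _ (trans (sym (off-path x x∉k)) (trans dx≡dy (off-path y y∉k)))

    landmark-separates : ∀ {x y} → OnPath k x → ¬ OnPath k y → μ x ≡ μ y → dist x ≢ dist y
    landmark-separates x∈k y∉k μx≡μy dx≡dy = <-irrefl (sym μx≡μy) (on-path-closer x∈k y∉k dx≡dy)

  module _ {μ : V → ℕ} {k k′ : Fin (suc n)} (k≢k′ : k ≢ k′) (A : Landmark μ k) (B : Landmark μ k′) where
    open Landmark

    private
      off-k : ∀ {x} → OnPath k′ x → ¬ OnPath k x
      off-k x∈k′ x∈k = k≢k′ (OnPath-unique x∈k x∈k′)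

      agree-one-sided : ∀ {x y} → OnPath k′ x → ¬ OnPath k′ y →
        dist A x ≡ dist A y → dist B x ≡ dist B y → μ x ≡ μ y
      agree-one-sided {x} {y} x∈k′ y∉k′ dA dB with OnPath? k y
      ... | yes y∈k = ⊥-elim (<-asym (on-path-closer B x∈k′ y∉k′ dB) (on-path-closer A y∈k (off-k x∈k′) (sym dA)))
      ... | no y∉k  = off-path-injective A (off-k x∈k′) y∉k dA

    landmarks-agree : ∀ x y → dist A x ≡ dist A y → dist B x ≡ dist B y → μ x ≡ μ y
    landmarks-agree x y dA dB with OnPath? k′ x | OnPath? k′ y
    ... | no x∉k′  | no y∉k′  = off-path-injective B x∉k′ y∉k′ dB
    ... | yes x∈k′ | yes y∈k′ = off-path-injective A (off-k x∈k′) (off-k y∈k′) dA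
    ... | yes x∈k′ | no y∉k′  = agree-one-sided x∈k′ y∉k′ dA dB
    ... | no x∉k′  | yes y∈k′ = sym (agree-one-sided y∈k′ x∉k′ (sym dA) (sym dB))

  -- w sits r edges from c₁ and far edges from c₂ on path k; the hypotheses on far say that
  -- leaving w towards c₂ is never shorter than going round through c₁, and at most one edge longer.
  module PathLandmark (k : Fin (suc n)) (r′ far : ℕ) (sₖ≡ : s k ≡ suc r′ + far)
                      (far≤ : far ≤ suc r′ + L) (≤far : suc r′ + L ≤ suc far) where

    r : ℕ
    r = suc r′

    r′<sₖ : r′ < s k
    r′<sₖ = subst (r′ <_) (sym sₖ≡) (m≤m+n r far)

    w-index : Fin (s k)
    w-index = fromℕ< r′<sₖ

    w-index≡r′ : toℕ w-index ≡ r′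
    w-index≡r′ = Fin.toℕ-fromℕ< r′<sₖ

    w : V
    w = inner k w-index

    dist-inner : ∀ i → Dec (i ≡ k) → Fin (s i) → ℕ
    dist-inner i (yes _) j = ∣ seg₁ j - r ∣
    dist-inner i (no _)  j = r + d₁ (inner i j)

    dist : V → ℕ
    dist c₁          = r + 0
    dist c₂          = r + L
    dist (inner i j) = dist-inner i (i Fin.≟ k) j

    r+-Lipschitz : ∀ {a b} → a ≤ suc b → r + a ≤ suc (r + b)
    r+-Lipschitz {b = b} a≤1+b = ≤-trans (+-monoʳ-≤ r a≤1+b) (≤-reflexive (+-suc r b))

    c₁-edge : ∀ i (j : Fin (s i)) → toℕ j ≡ 0 → ∀ d →
              r + 0 ≤ suc (dist-inner i d j) × dist-inner i d j ≤ suc (r + 0)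
    c₁-edge i j j≡0 (yes refl) rewrite j≡0 =
      ≤-reflexive (+-identityʳ r) , m≤n⇒m≤1+n (≤-trans (n≤1+n r′) (≤-reflexive (sym (+-identityʳ r))))
    c₁-edge i j j≡0 (no _) =
      r+-Lipschitz (d₁-Lipschitz (c₁-first i j j≡0)) , r+-Lipschitz (d₁-Lipschitz (first-c₁ i j j≡0))

    c₂-edge : ∀ i (j : Fin (s i)) → seg₁ j ≡ s i → ∀ d →
              dist-inner i d j ≤ suc (r + L) × r + L ≤ suc (dist-inner i d j)
    c₂-edge i j j≡last (yes refl) =
      subst (λ t → t ≤ suc (r + L) × r + L ≤ suc t) (sym last≡far) (m≤n⇒m≤1+n far≤ , ≤far)
      where
      last≡far : ∣ seg₁ j - r ∣ ≡ far
      last≡far = begin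
        ∣ seg₁ j - r ∣      ≡⟨ cong ∣_- r ∣ (trans j≡last sₖ≡) ⟩
        ∣ r + far - r ∣     ≡⟨ ∣-∣-comm (r + far) r ⟩
        ∣ r - r + far ∣     ≡⟨ ∣m-m+n∣≡n r far ⟩
        far                 ∎
        where open ≡-Reasoning
    c₂-edge i j j≡last (no _) =
      r+-Lipschitz (d₁-Lipschitz (last-c₂ i j j≡last)) , r+-Lipschitz (d₁-Lipschitz (c₂-last i j j≡last))

    path-edge : ∀ i (j j′ : Fin (s i)) → toℕ j′ ≡ suc (toℕ j) → ∀ d →
                dist-inner i d j ≤ suc (dist-inner i d j′) × dist-inner i d j′ ≤ suc (dist-inner i d j)
    path-edge i j j′ j′≡1+j (yes refl) rewrite j′≡1+j =
      ∣m-n∣≤1+∣1+m-n∣ (toℕ j) r′ , ∣1+m-n∣≤1+∣m-n∣ (toℕ j) r′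
    path-edge i j j′ j′≡1+j (no _) =
      r+-Lipschitz (d₁-Lipschitz (next i j j′ j′≡1+j)) , r+-Lipschitz (d₁-Lipschitz (prev i j j′ j′≡1+j))

    dist-Lipschitz : Lipschitz dist
    dist-Lipschitz (c₁-first i j j≡0)   = proj₁ (c₁-edge i j j≡0 (i Fin.≟ k))
    dist-Lipschitz (first-c₁ i j j≡0)   = proj₂ (c₁-edge i j j≡0 (i Fin.≟ k))
    dist-Lipschitz (last-c₂ i j j≡last) = proj₁ (c₂-edge i j j≡last (i Fin.≟ k))
    dist-Lipschitz (c₂-last i j j≡last) = proj₂ (c₂-edge i j j≡last (i Fin.≟ k))
    dist-Lipschitz (next i j j′ j′≡1+j) = proj₁ (path-edge i j j′ j′≡1+j (i Fin.≟ k))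
    dist-Lipschitz (prev i j j′ j′≡1+j) = proj₂ (path-edge i j j′ j′≡1+j (i Fin.≟ k))

    c₁→w : Walk G c₁ w r
    c₁→w = subst (Walk G c₁ w) (cong suc w-index≡r′) (reverse Adj-sym (to-c₁ w-index))

    inner→w : ∀ i (j : Fin (s i)) d → Walk G (inner i j) w (dist-inner i d j)
    inner→w i j (yes refl) = subst (λ t → Walk G (inner i j) w ∣ toℕ j - t ∣) w-index≡r′ (between j w-index)
    inner→w i j (no _)     = subst (Walk G (inner i j) w) (+-comm (d₁ (inner i j)) r) (d₁-walk (inner i j) ++ʷ c₁→w)

    walk-to-w : ∀ x → Walk G x w (dist x)
    walk-to-w c₁          = subst (Walk G c₁ w) (sym (+-identityʳ r)) c₁→w
    walk-to-w c₂          = subst (Walk G c₂ w) (+-comm L r) (c₂→c₁ ++ʷ c₁→w)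
    walk-to-w (inner i j) = inner→w i j (i Fin.≟ k)

    dist-w : ∀ d → dist-inner k d w-index ≡ 0
    dist-w (yes refl) = trans (cong ∣_- r′ ∣ w-index≡r′) (∣n-n∣≡0 r′)
    dist-w (no k≢k)   = ⊥-elim (k≢k refl)

    dist-off-path : ∀ i (j : Fin (s i)) → i ≢ k → ∀ d → dist-inner i d j ≡ r + d₁ (inner i j)
    dist-off-path i j i≢k (yes i≡k) = ⊥-elim (i≢k i≡k)
    dist-off-path i j i≢k (no _)    = refl

    dist-on-path : ∀ i (j : Fin (s i)) → i ≡ k → ∀ d → dist-inner i d j < r + d₁ (inner i j)
    dist-on-path i j i≡k (no i≢k)   = ⊥-elim (i≢k i≡k)
    dist-on-path i j i≡k (yes refl) =
      subst (∣ seg₁ j - r ∣ <_) (sym (+-distribˡ-⊓ r (seg₁ j) (seg₂ j + L)))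
        (⊓-glb (∣m-n∣<n+m z<s z<s)
               (∣m-n∣<n+o (subst (seg₁ j ≤_) sₖ≡ (Fin.toℕ<n j))
                          (≤-<-trans far≤ (+-monoʳ-< r (m<n+m L z<s))) z<s))

    landmark : Landmark d₁ k
    landmark = record
      { offset   = r
      ; vertex   = w
      ; dist     = dist
      ; isDist   = Lipschitz⇒Dist dist-Lipschitz (dist-w (k Fin.≟ k)) walk-to-w
      ; off-path = λ { c₁ _ → refl ; c₂ _ → refl ; (inner i j) i≢k → dist-off-path i j i≢k (i Fin.≟ k) }
      ; on-path  = λ { (inner i j) i≡k → dist-on-path i j i≡k (i Fin.≟ k) }
      }

  mirror : ∀ {k} → Landmark d₁ k → Landmark d₂ k
  mirror A = record
    { offset   = offset
    ; vertex   = σ vertex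
    ; dist     = λ x → dist (σ x)
    ; isDist   = λ x → subst (λ u → Dist G u (σ vertex) (dist (σ x))) (σ-involutive x)
                             (Dist-image σ σ-adj σ-involutive (isDist (σ x)))
    ; off-path = λ x x∉k → off-path (σ x) (λ σx∈k → x∉k (OnPath-σ x σx∈k))
    ; on-path  = λ { (inner i j) i≡k → on-path (inner i (opposite j)) i≡k }
    }
    where open Landmark A

module ResolvingSet {t : ℕ} (s : Fin (6 + t) → ℕ) (s-pos : ∀ i → 0 < s i)
                    (s₀-shortest : ∀ i → s zero ≤ s i) (s₀<s₁ : s zero < s (suc zero))
                    (s₀+2≤s : ∀ (l : Fin (4 + t)) → s zero + 2 ≤ s (suc (suc l))) where

  open ThetaGraph s s-pos s₀-shortest
  open Graph G
  open GraphDistance G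

  landmark-on : ∀ k → s zero + 2 ≤ s k → Landmark d₁ k
  landmark-on k s₀+2≤sₖ with middle-split s₀+2≤sₖ
  ... | r′ , far , sₖ≡ , far≤ , ≤far = PathLandmark.landmark k r′ far sₖ≡ far≤ ≤far

  profile : Fin (4 + t) → V → ℕ
  profile zero          = d₁
  profile (suc zero)    = d₁
  profile (suc (suc _)) = d₂

  landmark : ∀ l → Landmark (profile l) (suc (suc l))
  landmark zero          = landmark-on _ (s₀+2≤s zero)
  landmark (suc zero)    = landmark-on _ (s₀+2≤s (suc zero))
  landmark (suc (suc l)) = mirror (landmark-on _ (s₀+2≤s (suc (suc l))))

  vertex-of : Fin (4 + t) → V
  vertex-of l = Landmark.vertex (landmark l)

  dist-to : Fin (4 + t) → V → ℕ
  dist-to l = Landmark.dist (landmark l)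

  profile-≡ : ∀ l {x y} → d₁ x ≡ d₁ y → d₂ x ≡ d₂ y → profile l x ≡ profile l y
  profile-≡ zero          d₁≡ d₂≡ = d₁≡
  profile-≡ (suc zero)    d₁≡ d₂≡ = d₁≡
  profile-≡ (suc (suc _)) d₁≡ d₂≡ = d₂≡

  distinct-paths-separated : ∀ i i′ (j : Fin (s i)) (j′ : Fin (s i′)) → i ≢ i′ →
    d₁ (inner i j) ≡ d₁ (inner i′ j′) → d₂ (inner i j) ≡ d₂ (inner i′ j′) →
    (∀ l → dist-to l (inner i j) ≡ dist-to l (inner i′ j′)) → ⊥
  distinct-paths-separated (suc (suc l)) i′ j j′ i≢i′ d₁≡ d₂≡ same =
    landmark-separates (landmark l) refl (λ i′≡ → i≢i′ (sym i′≡)) (profile-≡ l d₁≡ d₂≡) (same l)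
  distinct-paths-separated i (suc (suc l)) j j′ i≢i′ d₁≡ d₂≡ same =
    landmark-separates (landmark l) refl i≢i′ (profile-≡ l (sym d₁≡) (sym d₂≡)) (sym (same l))
  distinct-paths-separated zero zero j j′ i≢i′ _ _ _ = i≢i′ refl
  distinct-paths-separated (suc zero) (suc zero) j j′ i≢i′ _ _ _ = i≢i′ refl
  distinct-paths-separated zero (suc zero) j j′ _ d₁≡ d₂≡ _ =
    <⇒≱ s₀<s₁ (profile-sum≤L⇒shortest j′ (subst (_≤ L) (cong₂ _+_ d₁≡ d₂≡) (shortest-path-profile j)))
  distinct-paths-separated (suc zero) zero j j′ _ d₁≡ d₂≡ _ =
    <⇒≱ s₀<s₁ (profile-sum≤L⇒shortest j (subst (_≤ L) (cong₂ _+_ (sym d₁≡) (sym d₂≡)) (shortest-path-profile j′)))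

  same-profile⇒≡ : ∀ x y → d₁ x ≡ d₁ y → d₂ x ≡ d₂ y → (∀ l → dist-to l x ≡ dist-to l y) → x ≡ y
  same-profile⇒≡ c₁ c₁ _ _ _ = refl
  same-profile⇒≡ c₂ c₂ _ _ _ = refl
  same-profile⇒≡ c₁ c₂ () _ _
  same-profile⇒≡ c₁ (inner i j) () _ _
  same-profile⇒≡ c₂ c₁ () _ _
  same-profile⇒≡ c₂ (inner i j) _ () _
  same-profile⇒≡ (inner i j) c₁ () _ _
  same-profile⇒≡ (inner i j) c₂ _ () _
  same-profile⇒≡ (inner i j) (inner i′ j′) d₁≡ d₂≡ same with i Fin.≟ i′
  ... | yes refl = cong (inner i) (same-path-profile j j′ d₁≡ d₂≡)
  ... | no i≢i′  = ⊥-elim (distinct-paths-separated i i′ j j′ i≢i′ d₁≡ d₂≡ same)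

  landmarks-resolve : ∀ x y → (∀ l → dist-to l x ≡ dist-to l y) → x ≡ y
  landmarks-resolve x y same = same-profile⇒≡ x y
    (landmarks-agree (λ ()) (landmark zero) (landmark (suc zero)) x y (same zero) (same (suc zero)))
    (landmarks-agree (λ ()) (landmark (suc (suc zero))) (landmark (suc (suc (suc zero)))) x y
                     (same (suc (suc zero))) (same (suc (suc (suc zero)))))
    same

  metricDim≤ : MetricDim≤ G (4 + t)
  metricDim≤ = tabulate vertex-of
             , resolving-by-coordinates vertex-of dist-to (λ l → Landmark.isDist (landmark l)) landmarks-resolve
             , ≤-reflexive (length-tabulate vertex-of)

mainTheorem12 : (m : ℕ) → 5 < m → (s : Fin m → ℕ) →
    (∀ i → 1 ≤ s i) →
    (∀ i j → i Data.Fin.≤ j → s i ≤ s j) →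
    (∀ i j → s i ≡ s j → i ≡ j) →
    MetricDim≤ (Theta m s) (m ∸ 2)
mainTheorem12 (suc (suc (suc (suc (suc (suc t)))))) (s≤s (s≤s (s≤s (s≤s (s≤s (s≤s z≤n)))))) s s-pos s-mono s-injective =
  ResolvingSet.metricDim≤ s s-pos (λ i → s-mono zero i z≤n) (s-strict (s≤s z≤n)) s₀+2≤s
  where
  s-strict : ∀ {i j} → i Data.Fin.< j → s i < s j
  s-strict {i} {j} i<j = ≤∧≢⇒< (s-mono i j (<⇒≤ i<j)) (λ sᵢ≡sⱼ → Fin.<-irrefl (s-injective i j sᵢ≡sⱼ) i<j)
  s₀+2≤s : ∀ l → s zero + 2 ≤ s (suc (suc l))
  s₀+2≤s l = ≤-trans (≤-reflexive (+-comm (s zero) 2))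
                     (≤-trans (s≤s (s-strict {zero} {suc zero} (s≤s z≤n)))
                              (≤-trans (s-strict {suc zero} {suc (suc zero)} (s≤s (s≤s z≤n)))
                                       (s-mono _ _ (s≤s (s≤s z≤n)))))
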